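{- The system $\mathsf{DG}+(\mathsf{KS}_0^{*})^{\mathrm{st}}$ is inconsistent, where $\mathsf{KS}_0^*$ is $(\forall\alpha\le_1 1)(\exists\beta\le_1 1)(\forall m^{0})\big[(\forall k^{0})(\alpha(k,m)=0)\leftrightarrow(\exists n^0)(\beta(n,m)=0)\big]$ (with $\alpha(k,m)$ denoting $\alpha$ applied to a code of the pair $(k,m)$), and $(\mathsf{KS}_0^{*})^{\mathrm{st}}$ is $(\forall^{\mathrm{st}}\alpha\le_1 1)(\exists^{\mathrm{st}}\beta\le_1 1)(\forall^{\mathrm{st}} m^{0})\big[(\forall^{\mathrm{st}} k^{0})(\alpha(k,m)=0)\leftrightarrow(\exists^{\mathrm{st}} n^0)(\beta(n,m)=0)\big]$.
   Context: Finite types: $0$ is a type and if $\rho,\sigma$ are types so is $\rho\to\sigma$; type $1=0\to0$, $2=1\to0$. $\mathsf{E\text{ - }HA}^{\omega}$ is Heyting arithmetic in all finite types (intuitionistic logic, Gödel's $T$ constants) with extensionality. Equality $=_0$ is primitive; for $\tau=\tau_1\to\dots\to\tau_k\to0$, $x=_\tau y$ abbreviates $(\forall z_1\dots z_k)(xz_1\dots z_k=_0yz_1\dots z_k)$, and $\le_\tau$ likewise. Extensionality $(\mathsf E_{\rho\to\tau})$: $(\forall\varphi)(\forall x,y)(x=_\rho y\to\varphi(x)=_\tau\varphi(y))$, for all types. Binary sequences: $f\le_1 1$. Strong majorizability (Howard–Bezem): $x\le^*_0 y$ iff $x\le_0 y$; $x\le^*_{\rho\to\sigma}y$ iff for all $u,v$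 with $u\le^*_\rho v$: $xu\le^*_\sigma yv$ and $yu\le^*_\sigma yv$. Monotone: $x\le^*x$; $\tilde\forall,\tilde\exists$ range over monotone objects. The language of $\mathsf{DG}$ adds predicates $\mathrm{st}^\sigma$ ("is standard"); $\forall^{\mathrm{st}},\exists^{\mathrm{st}}$ are the relativised quantifiers, $\tilde\forall^{\mathrm{st}},\tilde\exists^{\mathrm{st}}$ combine both restrictions. Internal = not containing $\mathrm{st}$. $\mathsf{DG}$ is $\mathsf{E\text{ - }HA}^\omega$ in the extended language plus: (a) $x=_\sigma y\to(\mathrm{st}(x)\to\mathrm{st}(y))$; (b) $\mathrm{st}(y)\to(x\le^*_\sigma y\to\mathrm{st}(x))$; (c) $\mathrm{st}(t)$ for closed terms $t$; (d) $\mathrm{st}(z)\to(\mathrm{st}(x)\to\mathrm{st}(zx))$; external induction $\Phi(0)\wedge(\forall^{\mathrm{st}}n)(\Phi(n)\to\Phi(n+1))\to(\forall^{\mathrm{st}}n)\Phi(n)$ for any $\Phi$; and for arbitrary $\Phi,\Psi$ and internal $\phi,\psi$: $\mathsf{mAC}^\omega$: $(\tilde\forall^{\mathrm{st}}x)(\tilde\exists^{\mathrm{st}}y)\Phi(x,y)\to(\tilde\exists^{\mathrm{st}}f)(\tilde\forall^{\mathrm{st}}x)(\exists y\le^*f(x))\Phi(x,y)$; $\mathsf R^\omega$: $(\forall x)(\exists^{\mathrm{st}}y)\Phi(x,y)\to(\tilde\exists^{\mathrm{st}}z)(\forall x)(\exists y\le^*z)\Phi(x,y)$; $\mathsf I^\omega$: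 $(\tilde\forall^{\mathrm{st}}z)(\exists x)(\forall y\le^*z)\phi(x,y)\to(\exists x)(\forall^{\mathrm{st}}y)\phi(x,y)$; $\mathsf{IP}^\omega_{\tilde\forall^{\mathrm{st}}}$: $[(\tilde\forall^{\mathrm{st}}x)\phi(x)\to(\tilde\exists^{\mathrm{st}}y)\Psi(y)]\to(\tilde\exists^{\mathrm{st}}z)[(\tilde\forall^{\mathrm{st}}x)\phi(x)\to(\tilde\exists y\le^*z)\Psi(y)]$; $\mathsf M^\omega$: $[(\tilde\forall^{\mathrm{st}}x)\phi(x)\to\psi]\to(\tilde\exists^{\mathrm{st}}y)[(\forall x\le^*y)\phi(x)\to\psi]$; $\mathsf{MAJ}^\omega$: $(\forall^{\mathrm{st}}x)(\exists^{\mathrm{st}}y)(x\le^*y)$. -}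

module Defs where

-- Deep embedding of the system DG (over E-HA^omega, combinatory Goedel T)
-- and of the sentence (KS_0^*)^st.

open import Data.List using (List; []; _∷_; map)
open import Data.List.Membership.Propositional using (_∈_)

data Ty : Set where
  ι   : Ty                 -- type 0
  _⇒_ : Ty → Ty → Ty
infixr 7 _⇒_

T1 : Ty
T1 = ι ⇒ ι

Ctx : Set
Ctx = List Ty

data _∋_ : Ctx → Ty → Set where
  here  : ∀ {Γ σ} → (σ ∷ Γ) ∋ σ
  there : ∀ {Γ σ τ} → Γ ∋ σ → (τ ∷ Γ) ∋ σ

-- Terms of Goedel's T (combinatory formulation: 0, S, Π (=K), Σ (=S), R_ρ)

data Tm (Γ : Ctx) : Ty → Set where
  var : ∀ {σ} → Γ ∋ σ → Tm Γ σ
  _·_ : ∀ {σ τ} → Tm Γ (σ ⇒ τ) → Tm Γ σ → Tm Γ τ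
  𝟎   : Tm Γ ι
  Suc : Tm Γ (ι ⇒ ι)
  Πc  : ∀ {ρ σ} → Tm Γ (ρ ⇒ σ ⇒ ρ)
  Σc  : ∀ {ρ σ τ} → Tm Γ ((ρ ⇒ σ ⇒ τ) ⇒ (ρ ⇒ σ) ⇒ ρ ⇒ τ)
  Rec : ∀ {ρ} → Tm Γ (ρ ⇒ (ρ ⇒ ι ⇒ ρ) ⇒ ι ⇒ ρ)
infixl 9 _·_

Ren : Ctx → Ctx → Set
Ren Γ Δ = ∀ {σ} → Γ ∋ σ → Δ ∋ σ

liftR : ∀ {Γ Δ τ} → Ren Γ Δ → Ren (τ ∷ Γ) (τ ∷ Δ)
liftR r here      = here
liftR r (there x) = there (r x)

renT : ∀ {Γ Δ σ} → Ren Γ Δ → Tm Γ σ → Tm Δ σ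
renT r (var x) = var (r x)
renT r (t · u) = renT r t · renT r u
renT r 𝟎       = 𝟎
renT r Suc     = Suc
renT r Πc      = Πc
renT r Σc      = Σc
renT r Rec     = Rec

Sub : Ctx → Ctx → Set
Sub Γ Δ = ∀ {σ} → Γ ∋ σ → Tm Δ σ

liftS : ∀ {Γ Δ τ} → Sub Γ Δ → Sub (τ ∷ Γ) (τ ∷ Δ)
liftS s here      = var here
liftS s (there x) = renT there (s x)

subT : ∀ {Γ Δ σ} → Sub Γ Δ → Tm Γ σ → Tm Δ σ
subT s (var x) = s x
subT s (t · u) = subT s t · subT s u
subT s 𝟎       = 𝟎
subT s Suc     = Suc
subT s Πc      = Πc
subT s Σc      = Σc
subT s Rec     = Rec

wk : ∀ {Γ σ τ} → Tm Γ σ → Tm (τ ∷ Γ) σ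
wk = renT there

v0 : ∀ {Γ σ} → Tm (σ ∷ Γ) σ
v0 = var here
v1 : ∀ {Γ σ τ} → Tm (τ ∷ σ ∷ Γ) σ
v1 = var (there here)
v2 : ∀ {Γ σ τ υ} → Tm (υ ∷ τ ∷ σ ∷ Γ) σ
v2 = var (there (there here))
v3 : ∀ {Γ σ τ υ ω} → Tm (ω ∷ υ ∷ τ ∷ σ ∷ Γ) σ
v3 = var (there (there (there here)))

-- bracket abstraction (a meta-level λ, producing T-terms)
lam : ∀ {Γ σ τ} → Tm (σ ∷ Γ) τ → Tm Γ (σ ⇒ τ)
lam {Γ} {σ} (var here) = Σc {Γ} {σ} {σ ⇒ σ} {σ} · Πc · Πc
lam (var (there x)) = Πc · var x
lam (t · u)         = Σc · lam t · lam u
lam 𝟎               = Πc · 𝟎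
lam Suc             = Πc · Suc
lam Πc              = Πc · Πc
lam Σc              = Πc · Σc
lam Rec             = Πc · Rec

addT : ∀ {Γ} → Tm Γ (ι ⇒ ι ⇒ ι)
addT = lam (lam (Rec · v1 · lam (lam (Suc · v1)) · v0))

predT : ∀ {Γ} → Tm Γ (ι ⇒ ι)
predT = lam (Rec · 𝟎 · lam (lam v0) · v0)

monusT : ∀ {Γ} → Tm Γ (ι ⇒ ι ⇒ ι)
monusT = lam (lam (Rec · v1 · lam (lam (predT · v1)) · v0))

triT : ∀ {Γ} → Tm Γ (ι ⇒ ι)
triT = lam (Rec · 𝟎 · lam (lam (addT · v1 · (Suc · v0))) · v0)

-- Cantor pairing  j(k,m) = (k+m)(k+m+1)/2 + m
pairT : ∀ {Γ} → Tm Γ (ι ⇒ ι ⇒ ι)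
pairT = lam (lam (addT · (triT · (addT · v1 · v0)) · v0))

one1 : ∀ {Γ} → Tm Γ T1
one1 {Γ} = Πc {Γ} {ι} {ι} · (Suc · 𝟎)

data Fm (Γ : Ctx) : Set where
  _≐_  : Tm Γ ι → Tm Γ ι → Fm Γ
  St   : ∀ {σ} → Tm Γ σ → Fm Γ
  ⊥'   : Fm Γ
  _∧'_ : Fm Γ → Fm Γ → Fm Γ
  _∨'_ : Fm Γ → Fm Γ → Fm Γ
  _⊃_  : Fm Γ → Fm Γ → Fm Γ
  All  : (σ : Ty) → Fm (σ ∷ Γ) → Fm Γ
  Ex   : (σ : Ty) → Fm (σ ∷ Γ) → Fm Γ
infix  6 _≐_
infixr 5 _∧'_
infixr 4 _∨'_
infixr 3 _⊃_

renF : ∀ {Γ Δ} → Ren Γ Δ → Fm Γ → Fm Δ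
renF r (s ≐ t)  = renT r s ≐ renT r t
renF r (St t)   = St (renT r t)
renF r ⊥'       = ⊥'
renF r (A ∧' B) = renF r A ∧' renF r B
renF r (A ∨' B) = renF r A ∨' renF r B
renF r (A ⊃ B)  = renF r A ⊃ renF r B
renF r (All σ A) = All σ (renF (liftR r) A)
renF r (Ex σ A)  = Ex σ (renF (liftR r) A)

subF : ∀ {Γ Δ} → Sub Γ Δ → Fm Γ → Fm Δ
subF s (a ≐ b)  = subT s a ≐ subT s b
subF s (St t)   = St (subT s t)
subF s ⊥'       = ⊥'
subF s (A ∧' B) = subF s A ∧' subF s B
subF s (A ∨' B) = subF s A ∨' subF s B
subF s (A ⊃ B)  = subF s A ⊃ subF s B
subF s (All σ A) = All σ (subF (liftS s) A)
subF s (Ex σ A)  = Ex σ (subF (liftS s) A)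

sub1 : ∀ {Γ σ} → Tm Γ σ → Sub (σ ∷ Γ) Γ
sub1 t here      = t
sub1 t (there x) = var x

_[_] : ∀ {Γ σ} → Fm (σ ∷ Γ) → Tm Γ σ → Fm Γ
A [ t ] = subF (sub1 t) A

sucSub : ∀ {Γ} → Sub (ι ∷ Γ) (ι ∷ Γ)
sucSub here      = Suc · v0
sucSub (there x) = var (there x)

data Internal {Γ : Ctx} : Fm Γ → Set where
  i≐  : ∀ {a b} → Internal (a ≐ b)
  i⊥  : Internal ⊥'
  i∧  : ∀ {A B} → Internal A → Internal B → Internal (A ∧' B)
  i∨  : ∀ {A B} → Internal A → Internal B → Internal (A ∨' B)
  i⊃  : ∀ {A B} → Internal A → Internal B → Internal (A ⊃ B)
  i∀  : ∀ {σ A} → Internal A → Internal (All σ A)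
  i∃  : ∀ {σ A} → Internal A → Internal (Ex σ A)

Le0 : ∀ {Γ} → Tm Γ ι → Tm Γ ι → Fm Γ
Le0 a b = monusT · a · b ≐ 𝟎

EqT : ∀ {Γ} (σ : Ty) → Tm Γ σ → Tm Γ σ → Fm Γ
EqT ι a b = a ≐ b
EqT (σ ⇒ τ) a b = All σ (EqT τ (wk a · v0) (wk b · v0))

LeT : ∀ {Γ} (σ : Ty) → Tm Γ σ → Tm Γ σ → Fm Γ
LeT ι a b = Le0 a b
LeT (σ ⇒ τ) a b = All σ (LeT τ (wk a · v0) (wk b · v0))

-- Howard–Bezem strong majorizability  x ≤*_σ y
Maj : ∀ {Γ} (σ : Ty) → Tm Γ σ → Tm Γ σ → Fm Γ
Maj ι a b = Le0 a b
Maj (ρ ⇒ σ) x y =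
  All ρ (All ρ (Maj ρ v1 v0 ⊃
    (Maj σ (wk (wk x) · v1) (wk (wk y) · v0) ∧' Maj σ (wk (wk y) · v1) (wk (wk y) · v0))))

Iff : ∀ {Γ} → Fm Γ → Fm Γ → Fm Γ
Iff A B = (A ⊃ B) ∧' (B ⊃ A)

AllSt : ∀ {Γ} (σ : Ty) → Fm (σ ∷ Γ) → Fm Γ
AllSt σ A = All σ (St v0 ⊃ A)

ExSt : ∀ {Γ} (σ : Ty) → Fm (σ ∷ Γ) → Fm Γ
ExSt σ A = Ex σ (St v0 ∧' A)

AllMSt : ∀ {Γ} (σ : Ty) → Fm (σ ∷ Γ) → Fm Γ
AllMSt σ A = All σ (St v0 ⊃ Maj σ v0 v0 ⊃ A)

ExMSt : ∀ {Γ} (σ : Ty) → Fm (σ ∷ Γ) → Fm Γ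
ExMSt σ A = Ex σ (St v0 ∧' Maj σ v0 v0 ∧' A)

ins2 : ∀ {Γ σ τ υ} → Ren (τ ∷ σ ∷ Γ) (τ ∷ σ ∷ υ ∷ Γ)
ins2 = liftR (liftR there)

ins1 : ∀ {Γ σ υ} → Ren (σ ∷ Γ) (σ ∷ υ ∷ Γ)
ins1 = liftR there

closed : ∀ {Γ} → Ren [] Γ
closed ()

-- Axioms of DG (schemata; every instance in every context Γ)

data Axiom : (Γ : Ctx) → Fm Γ → Set where
  eq-refl  : ∀ {Γ} (a : Tm Γ ι) → Axiom Γ (a ≐ a)
  eq-leib  : ∀ {Γ} (a b : Tm Γ ι) (s t : Tm (ι ∷ Γ) ι) →
             Axiom Γ (a ≐ b ⊃ subT (sub1 a) s ≐ subT (sub1 a) t ⊃ subT (sub1 b) s ≐ subT (sub1 b) t)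
  suc-ne   : ∀ {Γ} (a : Tm Γ ι) → Axiom Γ (Suc · a ≐ 𝟎 ⊃ ⊥')
  suc-inj  : ∀ {Γ} (a b : Tm Γ ι) → Axiom Γ (Suc · a ≐ Suc · b ⊃ a ≐ b)
  ind      : ∀ {Γ} (A : Fm (ι ∷ Γ)) → Internal A →
             Axiom Γ (A [ 𝟎 ] ∧' All ι (A ⊃ subF sucSub A) ⊃ All ι A)
  Π-ax     : ∀ {Γ ρ σ} (a : Tm Γ ρ) (b : Tm Γ σ) → Axiom Γ (EqT ρ (Πc · a · b) a)
  Σ-ax     : ∀ {Γ ρ σ τ} (a : Tm Γ (ρ ⇒ σ ⇒ τ)) (b : Tm Γ (ρ ⇒ σ)) (c : Tm Γ ρ) →
             Axiom Γ (EqT τ (Σc · a · b · c) (a · c · (b · c)))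
  R0-ax    : ∀ {Γ ρ} (a : Tm Γ ρ) (f : Tm Γ (ρ ⇒ ι ⇒ ρ)) →
             Axiom Γ (EqT ρ (Rec · a · f · 𝟎) a)
  RS-ax    : ∀ {Γ ρ} (a : Tm Γ ρ) (f : Tm Γ (ρ ⇒ ι ⇒ ρ)) (n : Tm Γ ι) →
             Axiom Γ (EqT ρ (Rec · a · f · (Suc · n)) (f · (Rec · a · f · n) · n))
  ext      : ∀ {Γ ρ τ} (φ : Tm Γ (ρ ⇒ τ)) (a b : Tm Γ ρ) →
             Axiom Γ (EqT ρ a b ⊃ EqT τ (φ · a) (φ · b))
  st-eq    : ∀ {Γ σ} (a b : Tm Γ σ) → Axiom Γ (EqT σ a b ⊃ St a ⊃ St b)
  st-maj   : ∀ {Γ σ} (a b : Tm Γ σ) → Axiom Γ (St b ⊃ Maj σ a b ⊃ St a)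
  st-cl    : ∀ {Γ σ} (t : Tm [] σ) → Axiom Γ (St (renT closed t))
  st-app   : ∀ {Γ σ τ} (z : Tm Γ (σ ⇒ τ)) (x : Tm Γ σ) → Axiom Γ (St z ⊃ St x ⊃ St (z · x))
  ext-ind  : ∀ {Γ} (A : Fm (ι ∷ Γ)) →
             Axiom Γ (A [ 𝟎 ] ∧' AllSt ι (A ⊃ subF sucSub A) ⊃ AllSt ι A)
  mAC      : ∀ {Γ σ τ} (Φ : Fm (τ ∷ σ ∷ Γ)) →
             Axiom Γ (AllMSt σ (ExMSt τ Φ) ⊃
                      ExMSt (σ ⇒ τ) (AllMSt σ (Ex τ (Maj τ v0 (v2 · v1) ∧' renF ins2 Φ))))
  Rω       : ∀ {Γ σ τ} (Φ : Fm (τ ∷ σ ∷ Γ)) →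
             Axiom Γ (All σ (ExSt τ Φ) ⊃
                      ExMSt τ (All σ (Ex τ (Maj τ v0 v2 ∧' renF ins2 Φ))))
  Iω       : ∀ {Γ σ τ} (φ : Fm (τ ∷ σ ∷ Γ)) → Internal φ →
             Axiom Γ (AllMSt τ (Ex σ (All τ (Maj τ v0 v2 ⊃ renF ins2 φ))) ⊃
                      Ex σ (AllSt τ φ))
  IPω      : ∀ {Γ σ τ} (φ : Fm (σ ∷ Γ)) (Ψ : Fm (τ ∷ Γ)) → Internal φ →
             Axiom Γ ((AllMSt σ φ ⊃ ExMSt τ Ψ) ⊃
                      ExMSt τ (AllMSt σ (renF ins1 φ) ⊃
                               Ex τ (Maj τ v0 v0 ∧' Maj τ v0 v1 ∧' renF ins1 Ψ)))
  Mω       : ∀ {Γ σ} (φ : Fm (σ ∷ Γ)) (ψ : Fm Γ) → Internal φ → Internal ψ →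
             Axiom Γ ((AllMSt σ φ ⊃ ψ) ⊃
                      ExMSt σ (All σ (Maj σ v0 v1 ⊃ renF ins1 φ) ⊃ renF there ψ))
  MAJω     : ∀ {Γ σ} → Axiom Γ (AllSt σ (ExSt σ (Maj σ v1 v0)))

-- Intuitionistic natural deduction, Γ = free variables, H = open assumptions

data Der : (Γ : Ctx) → List (Fm Γ) → Fm Γ → Set where
  hyp  : ∀ {Γ H A} → A ∈ H → Der Γ H A
  ax   : ∀ {Γ H A} → Axiom Γ A → Der Γ H A
  ∧I   : ∀ {Γ H A B} → Der Γ H A → Der Γ H B → Der Γ H (A ∧' B)
  ∧E₁  : ∀ {Γ H A B} → Der Γ H (A ∧' B) → Der Γ H A
  ∧E₂  : ∀ {Γ H A B} → Der Γ H (A ∧' B) → Der Γ H B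
  ∨I₁  : ∀ {Γ H A B} → Der Γ H A → Der Γ H (A ∨' B)
  ∨I₂  : ∀ {Γ H A B} → Der Γ H B → Der Γ H (A ∨' B)
  ∨E   : ∀ {Γ H A B C} → Der Γ H (A ∨' B) → Der Γ (A ∷ H) C → Der Γ (B ∷ H) C → Der Γ H C
  ⊃I   : ∀ {Γ H A B} → Der Γ (A ∷ H) B → Der Γ H (A ⊃ B)
  ⊃E   : ∀ {Γ H A B} → Der Γ H (A ⊃ B) → Der Γ H A → Der Γ H B
  ⊥E   : ∀ {Γ H A} → Der Γ H ⊥' → Der Γ H A
  ∀I   : ∀ {Γ H σ A} → Der (σ ∷ Γ) (map (renF there) H) A → Der Γ H (All σ A)
  ∀E   : ∀ {Γ H σ A} → Der Γ H (All σ A) → (t : Tm Γ σ) → Der Γ H (A [ t ])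
  ∃I   : ∀ {Γ H σ A} (t : Tm Γ σ) → Der Γ H (A [ t ]) → Der Γ H (Ex σ A)
  ∃E   : ∀ {Γ H σ A C} → Der Γ H (Ex σ A) →
         Der (σ ∷ Γ) (A ∷ map (renF there) H) (renF there C) → Der Γ H C

KS0*st : Fm []
KS0*st =
  All T1 (St v0 ⊃ LeT T1 v0 one1 ⊃
   Ex T1 (St v0 ∧' LeT T1 v0 one1 ∧'
    All ι (St v0 ⊃
     Iff (All ι (St v0 ⊃ v3 · (pairT · v0 · v1) ≐ 𝟎))
         (Ex ι (St v0 ∧' v2 · (pairT · v0 · v1) ≐ 𝟎)))))

module Submission where

-- Fix α and apply (KS₀*)^st to sg ∘ α at m = 0.  Through IP^ω and M^ω, the
-- standard equivalence "∀^st k sg α(j(k,0)) = 0 ↔ ∃^st n β(j(n,0)) = 0"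
-- yields a standard y such that sg ∘ α vanishing on [0, y] forces
-- sg α(j(k,0)) = 0 for every standard k.  As this holds for every α, R^ω
-- bounds y by one standard Y.  But α(x) = x ∸ Y vanishes on [0, Y], while
-- j(Y + 1, 0) ∸ Y ≠ 0 for the standard number Y + 1.

open import Data.List using (List; []; _∷_; map)
import Data.List.Relation.Unary.Any as Any
open import Relation.Binary.PropositionalEquality using (_≡_; refl; cong; cong₂; sym; trans; subst)
open import Defs

private variable
  Γ Δ : Ctx
  ρ σ τ : Ty
  H : List (Fm Γ)

renT-liftR-wk : (r : Ren Γ Δ) (a : Tm Γ σ) → renT (liftR {τ = τ} r) (wk a) ≡ wk (renT r a)
renT-liftR-wk r (var x) = refl
renT-liftR-wk r (t · u) = cong₂ _·_ (renT-liftR-wk r t) (renT-liftR-wk r u)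
renT-liftR-wk r 𝟎       = refl
renT-liftR-wk r Suc     = refl
renT-liftR-wk r Πc      = refl
renT-liftR-wk r Σc      = refl
renT-liftR-wk r Rec     = refl

subT-liftS-wk : (s : Sub Γ Δ) (a : Tm Γ σ) → subT (liftS {τ = τ} s) (wk a) ≡ wk (subT s a)
subT-liftS-wk s (var x) = refl
subT-liftS-wk s (t · u) = cong₂ _·_ (subT-liftS-wk s t) (subT-liftS-wk s u)
subT-liftS-wk s 𝟎       = refl
subT-liftS-wk s Suc     = refl
subT-liftS-wk s Πc      = refl
subT-liftS-wk s Σc      = refl
subT-liftS-wk s Rec     = refl

subT-sub1-wk : (c : Tm Γ τ) (a : Tm Γ σ) → subT (sub1 c) (wk a) ≡ a
subT-sub1-wk c (var x) = refl
subT-sub1-wk c (t · u) = cong₂ _·_ (subT-sub1-wk c t) (subT-sub1-wk c u)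
subT-sub1-wk c 𝟎       = refl
subT-sub1-wk c Suc     = refl
subT-sub1-wk c Πc      = refl
subT-sub1-wk c Σc      = refl
subT-sub1-wk c Rec     = refl

subT-var : (a : Tm Γ σ) → subT var a ≡ a
subT-var (var x) = refl
subT-var (t · u) = cong₂ _·_ (subT-var t) (subT-var u)
subT-var 𝟎       = refl
subT-var Suc     = refl
subT-var Πc      = refl
subT-var Σc      = refl
subT-var Rec     = refl

renF-EqT : ∀ τ (r : Ren Γ Δ) (a b : Tm Γ τ) → renF r (EqT τ a b) ≡ EqT τ (renT r a) (renT r b)
renF-EqT ι       r a b = refl
renF-EqT (σ ⇒ τ) r a b = cong (All σ) (trans (renF-EqT τ (liftR r) (wk a · v0) (wk b · v0))
  (cong₂ (λ x y → EqT τ (x · v0) (y · v0)) (renT-liftR-wk r a) (renT-liftR-wk r b)))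

subF-EqT : ∀ τ (s : Sub Γ Δ) (a b : Tm Γ τ) → subF s (EqT τ a b) ≡ EqT τ (subT s a) (subT s b)
subF-EqT ι       s a b = refl
subF-EqT (σ ⇒ τ) s a b = cong (All σ) (trans (subF-EqT τ (liftS s) (wk a · v0) (wk b · v0))
  (cong₂ (λ x y → EqT τ (x · v0) (y · v0)) (subT-liftS-wk s a) (subT-liftS-wk s b)))

h0 : ∀ {A : Fm Γ} {H} → Der Γ (A ∷ H) A
h0 = hyp (Any.here refl)
h1 : ∀ {A B : Fm Γ} {H} → Der Γ (B ∷ A ∷ H) A
h1 = hyp (Any.there (Any.here refl))
h2 : ∀ {A B C : Fm Γ} {H} → Der Γ (C ∷ B ∷ A ∷ H) A
h2 = hyp (Any.there (Any.there (Any.here refl)))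
h3 : ∀ {A B C D : Fm Γ} {H} → Der Γ (D ∷ C ∷ B ∷ A ∷ H) A
h3 = hyp (Any.there (Any.there (Any.there (Any.here refl))))
h4 : ∀ {A B C D E : Fm Γ} {H} → Der Γ (E ∷ D ∷ C ∷ B ∷ A ∷ H) A
h4 = hyp (Any.there (Any.there (Any.there (Any.there (Any.here refl)))))
h5 : ∀ {A B C D E F : Fm Γ} {H} → Der Γ (F ∷ E ∷ D ∷ C ∷ B ∷ A ∷ H) A
h5 = hyp (Any.there (Any.there (Any.there (Any.there (Any.there (Any.here refl))))))
h6 : ∀ {A B C D E F G : Fm Γ} {H} → Der Γ (G ∷ F ∷ E ∷ D ∷ C ∷ B ∷ A ∷ H) A
h6 = hyp (Any.there (Any.there (Any.there (Any.there (Any.there (Any.there (Any.here refl)))))))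

v4 : ∀ {Γ σ τ υ ω κ} → Tm (κ ∷ ω ∷ υ ∷ τ ∷ σ ∷ Γ) σ
v4 = var (there (there (there (there here))))

induction : (A : Fm (ι ∷ Γ)) → Internal A → Der Γ H (A [ 𝟎 ]) →
            Der (ι ∷ Γ) (A ∷ map (renF there) H) (subF sucSub A) → Der Γ H (All ι A)
induction A i base step = ⊃E (ax (ind A i)) (∧I base (∀I (⊃I step)))

standard-app : {f : Tm Γ (σ ⇒ τ)} {a : Tm Γ σ} → Der Γ H (St f) → Der Γ H (St a) → Der Γ H (St (f · a))
standard-app {f = f} {a} d e = ⊃E (⊃E (ax (st-app f a)) d) e

at-standard-zero : {A B : Fm Γ} {C : Fm (ι ∷ Γ)} → Der Γ H (A ∧' B ∧' AllSt ι C) → Der Γ H (C [ 𝟎 ])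
at-standard-zero d = ⊃E (∀E (∧E₂ (∧E₂ d)) 𝟎) (ax (st-cl 𝟎))

≐-refl : (a : Tm Γ ι) → Der Γ H (a ≐ a)
≐-refl a = ax (eq-refl a)

≐-subst : {a b : Tm Γ ι} → Der Γ H (a ≐ b) → (s t : Tm (ι ∷ Γ) ι) →
          Der Γ H (subT (sub1 a) s ≐ subT (sub1 a) t) → Der Γ H (subT (sub1 b) s ≐ subT (sub1 b) t)
≐-subst {a = a} {b} e s t d = ⊃E (⊃E (ax (eq-leib a b s t)) e) d

≐-sym : {a b : Tm Γ ι} → Der Γ H (a ≐ b) → Der Γ H (b ≐ a)
≐-sym {Γ = Γ} {H = H} {a} {b} e =
  subst (λ x → Der Γ H (b ≐ x)) (subT-sub1-wk b a)
    (≐-subst e v0 (wk a) (subst (λ x → Der Γ H (a ≐ x)) (sym (subT-sub1-wk a a)) (≐-refl a)))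

≐-trans : {a b c : Tm Γ ι} → Der Γ H (a ≐ b) → Der Γ H (b ≐ c) → Der Γ H (a ≐ c)
≐-trans {Γ = Γ} {H = H} {a} {b} {c} e₁ e₂ =
  subst (λ x → Der Γ H (x ≐ c)) (subT-sub1-wk c a)
    (≐-subst e₂ (wk a) v0 (subst (λ x → Der Γ H (x ≐ b)) (sym (subT-sub1-wk b a)) e₁))

module ≐-Reasoning {Γ : Ctx} {H : List (Fm Γ)} where

  infix  1 begin_
  infixr 2 _≐⟨_⟩_
  infix  3 _∎

  begin_ : {a b : Tm Γ ι} → Der Γ H (a ≐ b) → Der Γ H (a ≐ b)
  begin d = d

  _≐⟨_⟩_ : (a : Tm Γ ι) {b c : Tm Γ ι} → Der Γ H (a ≐ b) → Der Γ H (b ≐ c) → Der Γ H (a ≐ c)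
  a ≐⟨ d ⟩ e = ≐-trans d e

  _∎ : (a : Tm Γ ι) → Der Γ H (a ≐ a)
  a ∎ = ≐-refl a

open ≐-Reasoning

EqT-app : {f g : Tm Γ (σ ⇒ τ)} → Der Γ H (EqT (σ ⇒ τ) f g) → (c : Tm Γ σ) →
          Der Γ H (EqT τ (f · c) (g · c))
EqT-app {τ = τ} {f = f} {g} d c =
  subst (Der _ _) (trans (subF-EqT τ (sub1 c) (wk f · v0) (wk g · v0))
    (cong₂ (λ x y → EqT τ (x · c) (y · c)) (subT-sub1-wk c f) (subT-sub1-wk c g))) (∀E d c)

EqT-cong : (φ : Tm Γ (ρ ⇒ τ)) {a b : Tm Γ ρ} → Der Γ H (EqT ρ a b) → Der Γ H (EqT τ (φ · a) (φ · b))
EqT-cong φ {a} {b} d = ⊃E (ax (ext φ a b)) d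

-- Stated as an implication: the recursion on τ passes through ∀I, which
-- renames the hypotheses, so derivations of the premises cannot be carried along.
EqT-trans⊃ : ∀ τ (a b c : Tm Γ τ) → Der Γ H (EqT τ a b ⊃ EqT τ b c ⊃ EqT τ a c)
EqT-trans⊃ ι a b c = ⊃I (⊃I (≐-trans h1 h0))
EqT-trans⊃ (σ ⇒ τ) a b c = ⊃I (⊃I (∀I (⊃E (⊃E (EqT-trans⊃ τ (wk a · v0) (wk b · v0) (wk c · v0))
  (EqT-app (subst (Der _ _) (renF-EqT (σ ⇒ τ) there a b) h1) v0))
  (EqT-app (subst (Der _ _) (renF-EqT (σ ⇒ τ) there b c) h0) v0))))

EqT-trans : ∀ τ {a b c : Tm Γ τ} → Der Γ H (EqT τ a b) → Der Γ H (EqT τ b c) → Der Γ H (EqT τ a c)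
EqT-trans τ {a} {b} {c} d e = ⊃E (⊃E (EqT-trans⊃ τ a b c) d) e

extendS : Sub Γ Δ → Tm Δ σ → Sub (σ ∷ Γ) Δ
extendS s x here      = x
extendS s x (there y) = s y

-- Generalised over s because the abstraction of an application t · u is
-- Σc · lam t · lam u, and the inductive hypotheses are needed for subterms.
lam-β-subT : (s : Sub Γ Δ) (t : Tm (σ ∷ Γ) τ) (x : Tm Δ σ) →
             Der Δ H (EqT τ (subT s (lam t) · x) (subT (extendS s x) t))
lam-β-subT {σ = σ} s (var here) x = EqT-trans σ (ax (Σ-ax Πc Πc x)) (ax (Π-ax x (Πc · x)))
lam-β-subT s (var (there y)) x = ax (Π-ax (s y) x)
lam-β-subT {τ = τ} s (t · u) x =
  EqT-trans τ (ax (Σ-ax (subT s (lam t)) (subT s (lam u)) x))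
    (EqT-trans τ (EqT-app (lam-β-subT s t x) (subT s (lam u) · x))
      (EqT-cong (subT (extendS s x) t) (lam-β-subT s u x)))
lam-β-subT s 𝟎   x = ax (Π-ax 𝟎 x)
lam-β-subT s Suc x = ax (Π-ax Suc x)
lam-β-subT s Πc  x = ax (Π-ax Πc x)
lam-β-subT s Σc  x = ax (Π-ax Σc x)
lam-β-subT s Rec x = ax (Π-ax Rec x)

lam-β : (t : Tm (σ ∷ Γ) τ) (x : Tm Γ σ) → Der Γ H (EqT τ (lam t · x) (subT (extendS var x) t))
lam-β {τ = τ} {H = H} t x =
  subst (λ z → Der _ H (EqT τ (z · x) (subT (extendS var x) t))) (subT-var (lam t)) (lam-β-subT var t x)

lam²-β : (t : Tm (ρ ∷ σ ∷ Γ) τ) (x : Tm Γ σ) (y : Tm Γ ρ) →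
         Der Γ H (EqT τ (lam (lam t) · x · y) (subT (extendS (extendS var x) y) t))
lam²-β {τ = τ} t x y = EqT-trans τ (EqT-app (lam-β (lam t) x) y) (lam-β-subT (extendS var x) t y)

infixl 8 _+ᵀ_ _∸ᵀ_

_+ᵀ_ : Tm Γ ι → Tm Γ ι → Tm Γ ι
a +ᵀ b = addT · a · b

_∸ᵀ_ : Tm Γ ι → Tm Γ ι → Tm Γ ι
a ∸ᵀ b = monusT · a · b

pred-zero : Der Γ H (predT · 𝟎 ≐ 𝟎)
pred-zero = ≐-trans (lam-β (Rec · 𝟎 · lam (lam v0) · v0) 𝟎) (ax (R0-ax 𝟎 _))

pred-suc : (a : Tm Γ ι) → Der Γ H (predT · (Suc · a) ≐ a)
pred-suc a = ≐-trans (lam-β (Rec · 𝟎 · lam (lam v0) · v0) (Suc · a))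
  (≐-trans (ax (RS-ax 𝟎 _ a)) (lam²-β v0 _ a))

add-zero : (a : Tm Γ ι) → Der Γ H (a +ᵀ 𝟎 ≐ a)
add-zero a = ≐-trans (lam²-β (Rec · v1 · lam (lam (Suc · v1)) · v0) a 𝟎) (ax (R0-ax a _))

add-suc : (a b : Tm Γ ι) → Der Γ H (a +ᵀ Suc · b ≐ Suc · (a +ᵀ b))
add-suc a b = ≐-trans (lam²-β body a (Suc · b))
  (≐-trans (ax (RS-ax a _ b))
    (≐-trans (lam²-β (Suc · v1) _ b) (EqT-cong Suc (≐-sym (lam²-β body a b)))))
  where
  body : Tm (ι ∷ ι ∷ _) ι
  body = Rec · v1 · lam (lam (Suc · v1)) · v0

monus-zero : (a : Tm Γ ι) → Der Γ H (a ∸ᵀ 𝟎 ≐ a)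
monus-zero a = ≐-trans (lam²-β (Rec · v1 · lam (lam (predT · v1)) · v0) a 𝟎) (ax (R0-ax a _))

monus-suc : (a b : Tm Γ ι) → Der Γ H (a ∸ᵀ Suc · b ≐ predT · (a ∸ᵀ b))
monus-suc a b = ≐-trans (lam²-β body a (Suc · b))
  (≐-trans (ax (RS-ax a _ b))
    (≐-trans (lam²-β (predT · v1) _ b) (EqT-cong predT (≐-sym (lam²-β body a b)))))
  where
  body : Tm (ι ∷ ι ∷ _) ι
  body = Rec · v1 · lam (lam (predT · v1)) · v0

∸ᵀ-cong : {a a′ b b′ : Tm Γ ι} → Der Γ H (a ≐ a′) → Der Γ H (b ≐ b′) → Der Γ H (a ∸ᵀ b ≐ a′ ∸ᵀ b′)
∸ᵀ-cong {a = a} {a′} {b} e₁ e₂ =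
  ≐-trans (EqT-app {f = monusT · a} {g = monusT · a′} (EqT-cong monusT e₁) b) (EqT-cong (monusT · a′) e₂)

pred-suc-monus : Der Γ H (All ι (All ι (predT · (Suc · v1 ∸ᵀ v0) ≐ v1 ∸ᵀ v0)))
pred-suc-monus = ∀I (induction _ i≐
  (≐-trans (EqT-cong predT (monus-zero (Suc · v0))) (≐-trans (pred-suc v0) (≐-sym (monus-zero v0))))
  (≐-trans (EqT-cong predT (monus-suc (Suc · v1) v0))
    (≐-sym (≐-trans (monus-suc v1 v0) (EqT-cong predT (≐-sym h0))))))

suc-monus-suc : Der Γ H (All ι (All ι (Suc · v1 ∸ᵀ Suc · v0 ≐ v1 ∸ᵀ v0)))
suc-monus-suc = ∀I (∀I (≐-trans (monus-suc (Suc · v1) v0) (∀E (∀E pred-suc-monus v1) v0)))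

monus-self : Der Γ H (All ι (v0 ∸ᵀ v0 ≐ 𝟎))
monus-self = induction _ i≐ (monus-zero 𝟎)
  (≐-trans (monus-suc (Suc · v0) v0) (≐-trans (∀E (∀E pred-suc-monus v0) v0) h0))

zero-monus : Der Γ H (All ι (𝟎 ∸ᵀ v0 ≐ 𝟎))
zero-monus = induction _ i≐ (monus-zero 𝟎)
  (≐-trans (monus-suc 𝟎 v0) (≐-trans (EqT-cong predT h0) pred-zero))

suc-add-monus : Der Γ H (All ι (All ι (Suc · (v1 +ᵀ v0) ∸ᵀ v0 ≐ Suc · v1)))
suc-add-monus = ∀I (induction _ i≐
  (≐-trans (monus-zero _) (EqT-cong Suc (add-zero v0)))
  (≐-trans (∀E (∀E suc-monus-suc (v1 +ᵀ Suc · v0)) v0)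
    (≐-trans (∸ᵀ-cong (add-suc v1 v0) (≐-refl v0)) h0)))

zero-or-suc : Der Γ H (All ι (v0 ≐ 𝟎 ∨' Ex ι (v1 ≐ Suc · v0)))
zero-or-suc = induction _ (i∨ i≐ (i∃ i≐)) (∨I₁ (≐-refl 𝟎)) (∨I₂ (∃I v0 (≐-refl (Suc · v0))))

-- Induction on z.  In the step, x = 0 is immediate, y = 0 contradicts
-- x = S x' ≤ y, and S x' ≤ S y' ≤ S z reduces to x' ≤ y' ≤ z.
le-trans : Der Γ H (All ι (All ι (All ι (Le0 v0 v1 ⊃ Le0 v1 v2 ⊃ Le0 v0 v2))))
le-trans = induction _ (i∀ (i∀ (i⊃ i≐ (i⊃ i≐ i≐))))
  (∀I (∀I (⊃I (⊃I (≐-subst (≐-trans (≐-sym (monus-zero v1)) h0) (v1 ∸ᵀ v0) 𝟎 h1)))))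
  (∀I (∀I (⊃I (⊃I (∨E (∀E zero-or-suc v0)
    (≐-subst (≐-sym h0) (v0 ∸ᵀ Suc · v3) 𝟎 (∀E zero-monus (Suc · v2)))
    (∃E h0 (∨E (∀E zero-or-suc v2)
      (⊥E (⊃E (ax (suc-ne v0))
        (≐-trans (≐-sym h1) (≐-trans (≐-sym (monus-zero v1)) (≐-subst h0 (v2 ∸ᵀ v0) 𝟎 h4)))))
      (∃E h0
        (≐-trans (∸ᵀ-cong h2 (≐-refl _)) (≐-trans (∀E (∀E suc-monus-suc v1) v4)
          (⊃E (⊃E (∀E (∀E h6 v0) v1)
            (≐-trans (≐-sym (∀E (∀E suc-monus-suc v1) v0)) (≐-trans (∸ᵀ-cong (≐-sym h2) (≐-sym h0)) h5)))
            (≐-trans (≐-sym (∀E (∀E suc-monus-suc v0) v4)) (≐-trans (∸ᵀ-cong (≐-sym h0) (≐-refl _)) h4)))))))))))))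

sgT : Tm Γ (ι ⇒ ι)
sgT = Rec · 𝟎 · (Πc · (Πc · (Suc · 𝟎)))

sg-zero : Der Γ H (sgT · 𝟎 ≐ 𝟎)
sg-zero = ax (R0-ax 𝟎 _)

sg-suc : (a : Tm Γ ι) → Der Γ H (sgT · (Suc · a) ≐ Suc · 𝟎)
sg-suc a = ≐-trans (ax (RS-ax 𝟎 _ a))
  (≐-trans (EqT-app (ax (Π-ax (Πc · (Suc · 𝟎)) (sgT · a))) a) (ax (Π-ax (Suc · 𝟎) a)))

sg-le-one : Der Γ H (All ι (Le0 (sgT · v0) (Suc · 𝟎)))
sg-le-one = induction _ i≐
  (≐-trans (∸ᵀ-cong sg-zero (≐-refl _)) (∀E zero-monus (Suc · 𝟎)))
  (≐-trans (∸ᵀ-cong (sg-suc v0) (≐-refl _)) (∀E monus-self (Suc · 𝟎)))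

sg∘ : Tm Γ T1 → Tm Γ T1
sg∘ α = Σc · (Πc · sgT) · α

sg∘-app : (α : Tm Γ T1) (j : Tm Γ ι) → Der Γ H (sg∘ α · j ≐ sgT · (α · j))
sg∘-app α j = ≐-trans (ax (Σ-ax (Πc · sgT) α j)) (EqT-app {f = Πc · sgT · j} {g = sgT} (ax (Π-ax sgT j)) (α · j))

sg∘-le-one : (α : Tm Γ T1) (u v : Tm Γ ι) → Der Γ H (Le0 (sg∘ α · u) (one1 · v))
sg∘-le-one α u v = ≐-trans (∸ᵀ-cong (sg∘-app α u) (ax (Π-ax (Suc · 𝟎) v))) (∀E sg-le-one (α · u))

sg∘-majorised : ∀ {Γ} {H : List (Fm (T1 ∷ Γ))} → Der (T1 ∷ Γ) H (Maj T1 (sg∘ v0) one1)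
sg∘-majorised = ∀I (∀I (⊃I (∧I (sg∘-le-one v2 v1 v0)
  (≐-trans (∸ᵀ-cong (ax (Π-ax (Suc · 𝟎) v1)) (ax (Π-ax (Suc · 𝟎) v0))) (∀E monus-self (Suc · 𝟎))))))

sg∘-standard : ∀ {Γ} {H : List (Fm (T1 ∷ Γ))} → Der (T1 ∷ Γ) H (St (sg∘ v0))
sg∘-standard = ⊃E (⊃E (ax (st-maj (sg∘ v0) one1)) (ax (st-cl one1))) sg∘-majorised

sg∘-below-one : ∀ {Γ} {H : List (Fm (T1 ∷ Γ))} → Der (T1 ∷ Γ) H (LeT T1 (sg∘ v0) one1)
sg∘-below-one = ∀I (sg∘-le-one v1 v0 v0)

monusBy : Tm Γ ι → Tm Γ T1
monusBy Y = Σc · monusT · (Πc · Y)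

monusBy-app : (Y j : Tm Γ ι) → Der Γ H (monusBy Y · j ≐ j ∸ᵀ Y)
monusBy-app Y j = ≐-trans (ax (Σ-ax monusT (Πc · Y) j)) (EqT-cong (monusT · j) (ax (Π-ax Y j)))

tri : Tm Γ ι → Tm Γ ι
tri a = Rec · 𝟎 · lam (lam (v1 +ᵀ Suc · v0)) · a

pair-suc-zero : (a : Tm Γ ι) → Der Γ H (pairT · (Suc · a) · 𝟎 ≐ Suc · (tri a +ᵀ a))
pair-suc-zero a = begin
  pairT · (Suc · a) · 𝟎                  ≐⟨ lam²-β (triT · (v1 +ᵀ v0) +ᵀ v0) (Suc · a) 𝟎 ⟩
  triT · (Suc · a +ᵀ 𝟎) +ᵀ 𝟎              ≐⟨ add-zero _ ⟩
  triT · (Suc · a +ᵀ 𝟎)                   ≐⟨ EqT-cong triT (add-zero (Suc · a)) ⟩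
  triT · (Suc · a)                        ≐⟨ lam-β (tri v0) (Suc · a) ⟩
  tri (Suc · a)                           ≐⟨ ax (RS-ax 𝟎 _ a) ⟩
  lam (lam (v1 +ᵀ Suc · v0)) · tri a · a  ≐⟨ lam²-β (v1 +ᵀ Suc · v0) (tri a) a ⟩
  tri a +ᵀ Suc · a                        ≐⟨ add-suc (tri a) a ⟩
  Suc · (tri a +ᵀ a)                      ∎

Pair : Ty
Pair = ι ⇒ ι ⇒ ι

KS-clause : Fm (T1 ∷ T1 ∷ Pair ∷ [])
KS-clause = St v0 ∧' LeT T1 v0 one1 ∧'
  AllSt ι (Iff (AllSt ι (v3 · (v4 · v0 · v1) ≐ 𝟎)) (ExSt ι (v2 · (v4 · v0 · v1) ≐ 𝟎)))

KS0*st-p : Fm (Pair ∷ [])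
KS0*st-p = All T1 (St v0 ⊃ LeT T1 v0 one1 ⊃ Ex T1 KS-clause)

PairingFacts : Fm (Pair ∷ [])
PairingFacts = St v0 ∧' All ι (v1 · (Suc · v0) · 𝟎 ≐ Suc · (tri v0 +ᵀ v0)) ∧' KS0*st-p

pairing-facts : Der [] (KS0*st ∷ []) (Ex Pair PairingFacts)
pairing-facts = ∃I pairT (∧I (ax (st-cl pairT)) (∧I (∀I (pair-suc-zero v0)) h0))

Hp : List (Fm (Pair ∷ []))
Hp = PairingFacts ∷ renF there KS0*st ∷ []

-- In context y, α, p: sg ∘ α vanishing on [0, y] forces sg α(p(k,0)) = 0 for standard k.
Bounds : Fm (ι ∷ T1 ∷ Pair ∷ [])
Bounds = All ι (Le0 v0 v1 ⊃ sg∘ v2 · v0 ≐ 𝟎) ⊃ AllSt ι (sg∘ v2 · (v3 · v0 · 𝟎) ≐ 𝟎)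

KS-β : Fm (T1 ∷ T1 ∷ Pair ∷ [])
KS-β = St v0 ∧' LeT T1 v0 one1 ∧'
  AllSt ι (Iff (AllSt ι (sg∘ v3 · (v4 · v0 · v1) ≐ 𝟎)) (ExSt ι (v2 · (v4 · v0 · v1) ≐ 𝟎)))

Hβ : List (Fm (T1 ∷ T1 ∷ Pair ∷ []))
Hβ = KS-β ∷ map (renF there) (map (renF there) Hp)

αZeroAt βZeroAt : Fm (ι ∷ T1 ∷ T1 ∷ Pair ∷ [])
αZeroAt = sg∘ v2 · (v3 · v0 · 𝟎) ≐ 𝟎
βZeroAt = v1 · (v3 · v0 · 𝟎) ≐ 𝟎

-- Numbers are monotone (x ∸ x = 0), so ∀~st and ∀^st agree at type 0.
ip-premise : Der (T1 ∷ T1 ∷ Pair ∷ []) Hβ (AllMSt ι αZeroAt ⊃ ExMSt ι βZeroAt)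
ip-premise = ⊃I (∃E (⊃E (∧E₁ (at-standard-zero h1)) (∀I (⊃I (⊃E (⊃E (∀E h1 v0) h0) (∀E monus-self v0)))))
  (∃I v0 (∧I (∧E₁ h0) (∧I (∀E monus-self v0) (∧E₂ h0)))))

IPBound : Fm (ι ∷ T1 ∷ T1 ∷ Pair ∷ [])
IPBound = St v0 ∧' Maj ι v0 v0 ∧'
  (AllMSt ι (renF ins1 αZeroAt) ⊃ Ex ι (Maj ι v0 v0 ∧' Maj ι v0 v1 ∧' renF ins1 βZeroAt))

HN : List (Fm (ι ∷ T1 ∷ T1 ∷ Pair ∷ []))
HN = IPBound ∷ map (renF there) Hβ

αZero : Fm (ι ∷ ι ∷ T1 ∷ T1 ∷ Pair ∷ [])
αZero = sg∘ v3 · v0 ≐ 𝟎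

βZeroBelow : Fm (ι ∷ T1 ∷ T1 ∷ Pair ∷ [])
βZeroBelow = Ex ι (Le0 v0 v0 ∧' Le0 v0 v1 ∧' v2 · (v4 · v0 · 𝟎) ≐ 𝟎)

m-premise : Der (ι ∷ T1 ∷ T1 ∷ Pair ∷ []) HN (AllMSt ι αZero ⊃ βZeroBelow)
m-premise = ⊃I (⊃E (∧E₂ (∧E₂ h1)) (∀I (⊃I (⊃I (⊃E (⊃E (∀E h2 (v4 · v0 · 𝟎))
  (standard-app (standard-app (∧E₁ h5) h1) (ax (st-cl 𝟎))))
  (∀E monus-self (v4 · v0 · 𝟎)))))))

MBound : Fm (ι ∷ ι ∷ T1 ∷ T1 ∷ Pair ∷ [])
MBound = St v0 ∧' Maj ι v0 v0 ∧' (All ι (Maj ι v0 v1 ⊃ renF ins1 αZero) ⊃ renF there βZeroBelow)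

-- The bound y from M^ω itself works: the n ≤ N it yields is standard because N is.
bounds-from-M : Der (ι ∷ ι ∷ T1 ∷ T1 ∷ Pair ∷ []) (MBound ∷ map (renF there) HN)
                  (renF there (renF there (renF there (ExSt ι Bounds))))
bounds-from-M = ∃I v0 (∧I (∧E₁ h0) (⊃I (∃E (⊃E (∧E₂ (∧E₂ h1)) h0)
  (⊃E (∧E₂ (at-standard-zero h4))
    (∃I v0 (∧I (⊃E (⊃E (ax (st-maj v0 v2)) (∧E₁ h3)) (∧E₁ (∧E₂ h0))) (∧E₂ (∧E₂ h0))))))))

bounds-from-IP : Der (ι ∷ T1 ∷ T1 ∷ Pair ∷ []) HN (renF there (renF there (ExSt ι Bounds)))
bounds-from-IP = ∃E (⊃E (ax (Mω αZero βZeroBelow i≐ (i∃ (i∧ i≐ (i∧ i≐ i≐))))) m-premise) bounds-from-M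

bounds-from-KS : Der (T1 ∷ T1 ∷ Pair ∷ []) Hβ (renF there (ExSt ι Bounds))
bounds-from-KS = ∃E (⊃E (ax (IPω αZeroAt βZeroAt i≐)) ip-premise) bounds-from-IP

bound-for-each-α : Der (T1 ∷ Pair ∷ []) (map (renF there) Hp) (ExSt ι Bounds)
bound-for-each-α = ∃E (⊃E (⊃E (∀E (∧E₂ (∧E₂ h0)) (sg∘ v0)) sg∘-standard) sg∘-below-one) bounds-from-KS

UniformBound : Fm (ι ∷ Pair ∷ [])
UniformBound = St v0 ∧' Maj ι v0 v0 ∧' All T1 (Ex ι (Maj ι v0 v2 ∧' renF ins2 Bounds))

BoundForMonusBy : Fm (ι ∷ ι ∷ Pair ∷ [])
BoundForMonusBy = Le0 v0 v1 ∧'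
  (All ι (Le0 v0 v1 ⊃ sg∘ (monusBy v2) · v0 ≐ 𝟎) ⊃ AllSt ι (sg∘ (monusBy v2) · (v3 · v0 · 𝟎) ≐ 𝟎))

HY : List (Fm (ι ∷ ι ∷ Pair ∷ []))
HY = BoundForMonusBy ∷ map (renF there) (UniformBound ∷ map (renF there) Hp)

monusBy-vanishes-below : Der (ι ∷ ι ∷ Pair ∷ []) HY (All ι (Le0 v0 v1 ⊃ sg∘ (monusBy v2) · v0 ≐ 𝟎))
monusBy-vanishes-below = ∀I (⊃I (begin
  sg∘ (monusBy v2) · v0    ≐⟨ sg∘-app _ v0 ⟩
  sgT · (monusBy v2 · v0)  ≐⟨ EqT-cong sgT (≐-trans (monusBy-app v2 v0)
                                (⊃E (⊃E (∀E (∀E (∀E le-trans v2) v1) v0) h0) (∧E₁ h1))) ⟩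
  sgT · 𝟎                  ≐⟨ sg-zero ⟩
  𝟎                        ∎))

monusBy-bound-fails : Der (ι ∷ ι ∷ Pair ∷ []) HY ⊥'
monusBy-bound-fails = ⊃E (ax (suc-ne 𝟎)) (≐-trans (≐-sym value) vanishes)
  where
  vanishes : Der (ι ∷ ι ∷ Pair ∷ []) HY (sg∘ (monusBy v1) · (v2 · (Suc · v1) · 𝟎) ≐ 𝟎)
  vanishes = ⊃E (∀E (⊃E (∧E₂ h0) monusBy-vanishes-below) (Suc · v1))
    (standard-app (ax (st-cl Suc)) (∧E₁ h1))

  value : Der (ι ∷ ι ∷ Pair ∷ []) HY (sg∘ (monusBy v1) · (v2 · (Suc · v1) · 𝟎) ≐ Suc · 𝟎)
  value = begin
    sg∘ (monusBy v1) · (v2 · (Suc · v1) · 𝟎)   ≐⟨ sg∘-app _ _ ⟩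
    sgT · (monusBy v1 · (v2 · (Suc · v1) · 𝟎)) ≐⟨ EqT-cong sgT (begin
      monusBy v1 · (v2 · (Suc · v1) · 𝟎)       ≐⟨ monusBy-app v1 _ ⟩
      v2 · (Suc · v1) · 𝟎 ∸ᵀ v1                ≐⟨ ∸ᵀ-cong (∀E (∧E₁ (∧E₂ h2)) v1) (≐-refl v1) ⟩
      Suc · (tri v1 +ᵀ v1) ∸ᵀ v1               ≐⟨ ∀E (∀E suc-add-monus (tri v1)) v1 ⟩
      Suc · tri v1                             ∎) ⟩
    sgT · (Suc · tri v1)                       ≐⟨ sg-suc (tri v1) ⟩
    Suc · 𝟎                                    ∎

uniform-bound-fails : Der (ι ∷ Pair ∷ []) (UniformBound ∷ map (renF there) Hp) ⊥'
uniform-bound-fails = ∃E (∀E (∧E₂ (∧E₂ h0)) (monusBy v0)) monusBy-bound-fails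

theorem3p24 : Der [] (KS0*st ∷ []) ⊥'
theorem3p24 =
  ∃E pairing-facts
    (∃E (⊃E (ax (Rω Bounds)) (∀I bound-for-each-α))
      uniform-bound-fails)
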